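{- Let $\overline{\mathcal D}=(\overline X,\overline{\mathcal B},\overline\rho)$ be a $t$-divisible design with $\overline X\subset X$, $X$ finite, and let $G$ be a group acting on $X$ such that conditions (a)–(e) below hold; let $\mathcal D=(X,\mathcal B,\rho)$ be the resulting $t$-lifting, i.e. $\mathcal B=\{\overline B^g\mid\overline B\in\overline{\mathcal B},g\in G\}$ and $\rho=\{(x,x')\mid(\widehat x,\widehat x')\in\overline\rho\}$. Conditions: (a) for each $x\in X$ there is a unique $\widehat x\in\overline X$ with $x^G=\widehat x^G$; (b) all orbits $\overline x^G$, $\overline x\in\overline X$, have the same size; (c) for any $Y=\{y_1,\dots,y_t\}\subseteq X$ such that $\widehat Y=\{\widehat y_1,\dots,\widehat y_t\}$ is a $\overline\rho$-transversal $t$-subset of $\overline X$, some $g\in G$ satisfies $Y^g=\widehat Y$; (d) all setwise stabilizers $G_{\overline Y}$ of $\overline\rho$-transversal $t$-subsets $\overline Y\subseteq\overline X$ have the same size; (e) all setwise stabilizers $G_{\overline B}$, $\overline B\in\overline{\mathcal B}$, have the same size. Assume that there is a group $\overline H$ of automorphisms of $\overline{\mathcal D}$ which acts transitively on $\overline{\mathcal B}$ and transitively on the set of $\overline\rho$-transversal $t$-subsets of $\overline X$. If each $\overline h\in\overline H$ can be extended to an automorphism of $\mathcal D$, then $\mathcal D$ admits a group of automorphisms which acts transitively on $\mathcal B$ and transitively on the set of $\rho$-transversal $t$-subsets of $X$. Hence $\mathcal D$ can also be obtained with Spera's construction.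
   Context: A $t$-divisible design $(X,\mathcal B,\rho)$: $X$ finite set, $\rho$ an equivalence relation on $X$ (classes = point classes), a subset is $\rho$-transversal if it meets each point class in at most one point; there are positive integers $s,k,\lambda_t$ such that every block in $\mathcal B$ is a $\rho$-transversal $k$-subset, every point class has size $s$, every $\rho$-transversal $t$-subset lies in exactly $\lambda_t$ blocks, and $t\le \#X/s$. Under the hypotheses (a)–(e), $(X,\mathcal B,\rho)$ is again a $t$-divisible design, called the $t$-lifting of $\overline{\mathcal D}$ under $G$. An automorphism of a divisible design is a permutation of its point set mapping blocks onto blocks and point classes onto point classes. Spera's construction (A. G. Spera, 1992) produces a $t$-divisible design from a point set with equivalence relation, a group acting on it and a base block (the blocks being the orbit of the base block); a $t$-divisible design can be obtained by Spera's construction if and only if it admits a group of automorphisms acting transitively on the blocks and transitively on the transversal $t$-subsets of points. -}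

module Defs where

open import Data.Unit using (⊤)
open import Data.Nat using (ℕ; _*_; _≤_; _>_)
open import Data.Fin using (Fin; _≟_)
open import Data.Fin.Properties using (any?)
open import Data.Fin.Subset using (Subset; _∈_; _⊆_; ∣_∣)
open import Data.Fin.Subset.Properties using (_∈?_)
open import Data.Vec using (tabulate)
open import Data.List using (List; length)
open import Data.List.Membership.Propositional using () renaming (_∈_ to _∈ₗ_)
open import Data.List.Relation.Unary.Unique.Propositional using (Unique)
open import Data.Product using (Σ; ∃; ∃-syntax; _×_; _,_)
open import Function using (_∘_; id)
open import Function.Bundles using (_⇔_)
open import Relation.Nullary using (does)
open import Relation.Nullary.Decidable using (_×-dec_)
open import Relation.Binary.PropositionalEquality using (_≡_)
open import Relation.Binary.Structures using (IsEquivalence)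
open import Algebra.Structures using (IsGroup)

HasSize : {A : Set} → (A → Set) → ℕ → Set
HasSize {A} P m =
  Σ (List A) λ l → Unique l × length l ≡ m × (∀ a → (a ∈ₗ l) ⇔ P a)

-- Points are Fin n.  Image of a subset under a map:  f ⟨$⟩ S = S^f.

_⟨$⟩_ : {n : ℕ} → (Fin n → Fin n) → Subset n → Subset n
f ⟨$⟩ S = tabulate λ z → does (any? λ x → (x ∈? S) ×-dec (f x ≟ z))

Transversal : {n : ℕ} → Subset n → (Fin n → Fin n → Set) → Subset n → Set
Transversal P ρ Y = Y ⊆ P × (∀ x y → x ∈ Y → y ∈ Y → ρ x y → x ≡ y)

TransversalT : {n : ℕ} → ℕ → Subset n → (Fin n → Fin n → Set) → Subset n → Set
TransversalT t P ρ Y = Transversal P ρ Y × ∣ Y ∣ ≡ t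

-- (P, 𝔅, ρ) is a t-divisible design on the point set P ⊆ Fin n.
-- ρ is an equivalence relation on Fin n; only its restriction to P matters.
-- The block set 𝔅 is a predicate on subsets (so blocks form a set).

record IsTDivisibleDesign {n : ℕ} (t : ℕ) (P : Subset n)
         (ρ : Fin n → Fin n → Set) (𝔅 : Subset n → Set) : Set where
  field
    ρ-equiv   : IsEquivalence ρ
    s k λt    : ℕ
    s>0       : s > 0
    k>0       : k > 0
    λt>0      : λt > 0
    blocks    : ∀ B → 𝔅 B → Transversal P ρ B × ∣ B ∣ ≡ k
    classes   : ∀ x → x ∈ P → HasSize (λ y → y ∈ P × ρ x y) s
    balanced  : ∀ Y → TransversalT t P ρ Y → HasSize (λ B → 𝔅 B × Y ⊆ B) λt
    t≤#X/s    : t * s ≤ ∣ P ∣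

-- f (a map Fin n → Fin n, of which only the restriction to P matters)
-- restricts to an automorphism of (P, 𝔅, ρ).

record IsAutomorphism {n : ℕ} (P : Subset n) (ρ : Fin n → Fin n → Set)
         (𝔅 : Subset n → Set) (f : Fin n → Fin n) : Set where
  field
    maps-P     : ∀ x → x ∈ P → f x ∈ P
    inverse    : Fin n → Fin n
    inverse-P  : ∀ x → x ∈ P → inverse x ∈ P
    left-inv   : ∀ x → x ∈ P → inverse (f x) ≡ x
    right-inv  : ∀ x → x ∈ P → f (inverse x) ≡ x
    classes    : ∀ x y → x ∈ P → y ∈ P → ρ x y ⇔ ρ (f x) (f y)
    blocks     : ∀ B → 𝔅 B → 𝔅 (f ⟨$⟩ B)
    blocks-onto : ∀ B → 𝔅 B → ∃[ B' ] (𝔅 B' × f ⟨$⟩ B' ≡ B)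

-- H (a set of maps, considered as permutations of P) is a group of
-- automorphisms of (P, 𝔅, ρ).
record IsAutGroup {n : ℕ} (P : Subset n) (ρ : Fin n → Fin n → Set)
         (𝔅 : Subset n → Set) (H : (Fin n → Fin n) → Set) : Set where
  field
    auts   : ∀ h → H h → IsAutomorphism P ρ 𝔅 h
    id∈    : H id
    ∘∈     : ∀ h h' → H h → H h' → H (h ∘ h')
    inv∈   : ∀ h → H h → ∃[ h' ] (H h' × (∀ x → x ∈ P → h' (h x) ≡ x)
                                        × (∀ x → x ∈ P → h (h' x) ≡ x))

BlockTransitive : {n : ℕ} → (Subset n → Set) → ((Fin n → Fin n) → Set) → Set
BlockTransitive 𝔅 H = ∀ B B' → 𝔅 B → 𝔅 B' → ∃[ h ] (H h × h ⟨$⟩ B ≡ B')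

TTransitive : {n : ℕ} → ℕ → Subset n → (Fin n → Fin n → Set)
              → ((Fin n → Fin n) → Set) → Set
TTransitive t P ρ H = ∀ Y Y' → TransversalT t P ρ Y → TransversalT t P ρ Y'
                      → ∃[ h ] (H h × h ⟨$⟩ Y ≡ Y')

record FiniteGroupAction (n : ℕ) : Set₁ where
  field
    G       : Set
    _·_     : G → G → G
    e       : G
    _⁻¹     : G → G
    isGroup : IsGroup _≡_ _·_ e _⁻¹
    finite  : ∃[ m ] HasSize {G} (λ _ → ⊤) m
    _^_     : Fin n → G → Fin n
    act-e   : ∀ x → x ^ e ≡ x
    act-·   : ∀ x g h → x ^ (g · h) ≡ (x ^ g) ^ h

  act : G → Fin n → Fin n
  act g x = x ^ g

  Orbit : Fin n → Fin n → Set
  Orbit x z = ∃[ g ] (x ^ g ≡ z)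

  Stab : Subset n → G → Set
  Stab S g = act g ⟨$⟩ S ≡ S

liftedBlocks : {n : ℕ} → (A : FiniteGroupAction n) → (Subset n → Set) → Subset n → Set
liftedBlocks A 𝔅̄ B = ∃[ B̄ ] ∃[ g ] (𝔅̄ B̄ × act g ⟨$⟩ B̄ ≡ B)
  where open FiniteGroupAction A

liftedρ : {n : ℕ} → (Fin n → Fin n) → (Fin n → Fin n → Set) → Fin n → Fin n → Set
liftedρ hat ρ̄ x x' = ρ̄ (hat x) (hat x')

record LiftingConditions {n : ℕ} (t : ℕ) (X̄ : Subset n) (ρ̄ : Fin n → Fin n → Set)
         (𝔅̄ : Subset n → Set) (A : FiniteGroupAction n) (hat : Fin n → Fin n) : Set where
  open FiniteGroupAction A
  field
    a-in     : ∀ x → hat x ∈ X̄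
    a-orbit  : ∀ x z → Orbit x z ⇔ Orbit (hat x) z
    a-unique : ∀ x y → y ∈ X̄ → (∀ z → Orbit x z ⇔ Orbit y z) → y ≡ hat x
    b        : ∃[ m ] (∀ x̄ → x̄ ∈ X̄ → HasSize (Orbit x̄) m)
    c        : ∀ Y → ∣ Y ∣ ≡ t → TransversalT t X̄ ρ̄ (hat ⟨$⟩ Y)
               → ∃[ g ] (act g ⟨$⟩ Y ≡ hat ⟨$⟩ Y)
    d        : ∃[ m ] (∀ Ȳ → TransversalT t X̄ ρ̄ Ȳ → HasSize (Stab Ȳ) m)
    e'       : ∃[ m ] (∀ B̄ → 𝔅̄ B̄ → HasSize (Stab B̄) m)

module Submission where

-- We take for H the full automorphism group of D.  Every element g ∈ G acts
-- as an automorphism of D, since x ↦ x̂ is constant on G-orbits (condition (a)).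
-- Two lifted blocks B = B̄^g, B' = B̄'^g' are connected by g⁻¹, then an extension
-- φ of some h̄ ∈ H̄ with B̄^h̄ = B̄', then g'.  Two ρ-transversal t-subsets Y, Y'
-- have ρ̄-transversal t-subsets Ŷ, Ŷ' of X̄ as images under hat; condition (c)
-- gives g, g' ∈ G with Y^g = Ŷ and Y'^g' = Ŷ', and Y is moved to Y' by g,
-- an extension of an element of H̄ taking Ŷ to Ŷ', and g'⁻¹.

open import Defs
open import Data.Nat using (ℕ)
open import Data.Fin using (Fin)
open import Data.Fin.Subset using (Subset; _∈_; ⊤)
open import Data.Product using (∃-syntax; _×_)
open import Relation.Binary.PropositionalEquality using (_≡_)

open import Data.Nat using (zero; suc)
open import Data.Nat.Properties using (suc-injective; 1+n≢0)
open import Data.Fin using (_≟_)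
open import Data.Fin.Properties using (any?)
open import Data.Fin.Subset using (_─_; _-_; ⁅_⁆; ∣_∣; ⊥; _⊆_; _∉_; inside; outside)
open import Data.Fin.Subset.Properties
  using (_∈?_; p─⊥≡p; ⊆-antisym; ∉⊥; ∣⊥∣≡0; nonempty?; Empty-unique; p─q⊆p; x∈p∧x≢y⇒x∈p-y; x∈⁅x⁆; ∈⊤)
open import Data.Vec using (_∷_; here; there)
open import Data.Vec.Properties using (lookup∘tabulate; []=⇒lookup; lookup⇒[]=)
open import Data.Product using (_,_; proj₁; proj₂)
open import Data.Bool using (true; false)
open import Data.Empty using (⊥-elim)
open import Function using (_∘_; id)
open import Function.Bundles using (_⇔_; mk⇔; Equivalence)
open import Relation.Nullary using (yes; no; ¬_)
open import Relation.Nullary.Decidable using (_×-dec_; dec-true; dec-false; decidable-stable)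
open import Relation.Binary.PropositionalEquality using (refl; sym; trans; cong; subst; subst₂; module ≡-Reasoning)
open import Relation.Binary.Structures using (IsEquivalence)
open import Algebra.Structures using (IsGroup)

module Images {n : ℕ} where

  ∈-image⁺ : (f : Fin n → Fin n) (T : Subset n) {x : Fin n} → x ∈ T → f x ∈ f ⟨$⟩ T
  ∈-image⁺ f T {x} x∈T = lookup⇒[]= (f x) (f ⟨$⟩ T)
    (trans (lookup∘tabulate _ (f x))
           (dec-true (any? λ y → (y ∈? T) ×-dec (f y ≟ f x)) (x , x∈T , refl)))

  ∈-image⁻ : (f : Fin n → Fin n) (T : Subset n) {z : Fin n} → z ∈ f ⟨$⟩ T → ∃[ x ] (x ∈ T × f x ≡ z)
  ∈-image⁻ f T {z} z∈fT = decidable-stable witness? (λ no-witness →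
      false≢true (trans (sym (dec-false witness? no-witness)) z-marked))
    where
    witness? = any? λ y → (y ∈? T) ×-dec (f y ≟ z)
    z-marked = trans (sym (lookup∘tabulate _ z)) ([]=⇒lookup z∈fT)
    false≢true : ¬ (false ≡ true)
    false≢true ()

  image-cong : (f g : Fin n → Fin n) (T : Subset n) → (∀ x → x ∈ T → f x ≡ g x) → f ⟨$⟩ T ≡ g ⟨$⟩ T
  image-cong f g T f≗g = ⊆-antisym (transfer f g f≗g) (transfer g f (λ x x∈T → sym (f≗g x x∈T)))
    where
    transfer : ∀ u v → (∀ x → x ∈ T → u x ≡ v x) → u ⟨$⟩ T ⊆ v ⟨$⟩ T
    transfer u v u≗v z∈ with ∈-image⁻ u T z∈
    ... | x , x∈T , refl = subst (_∈ v ⟨$⟩ T) (sym (u≗v x x∈T)) (∈-image⁺ v T x∈T)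

  image-∘ : (f g : Fin n → Fin n) (T : Subset n) → (f ∘ g) ⟨$⟩ T ≡ f ⟨$⟩ (g ⟨$⟩ T)
  image-∘ f g T = ⊆-antisym to from
    where
    to : (f ∘ g) ⟨$⟩ T ⊆ f ⟨$⟩ (g ⟨$⟩ T)
    to z∈ with ∈-image⁻ (f ∘ g) T z∈
    ... | x , x∈T , refl = ∈-image⁺ f _ (∈-image⁺ g T x∈T)
    from : f ⟨$⟩ (g ⟨$⟩ T) ⊆ (f ∘ g) ⟨$⟩ T
    from z∈ with ∈-image⁻ f _ z∈
    ... | y , y∈gT , refl with ∈-image⁻ g T y∈gT
    ...   | x , x∈T , refl = ∈-image⁺ (f ∘ g) T x∈T

  image-id : (T : Subset n) → id ⟨$⟩ T ≡ T
  image-id T = ⊆-antisym to (∈-image⁺ id T)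
    where
    to : id ⟨$⟩ T ⊆ T
    to z∈ with ∈-image⁻ id T z∈
    ... | x , x∈T , refl = x∈T

  image-inverse : (f g : Fin n → Fin n) (T : Subset n) → (∀ x → g (f x) ≡ x) → g ⟨$⟩ (f ⟨$⟩ T) ≡ T
  image-inverse f g T g∘f≗id = begin
    g ⟨$⟩ (f ⟨$⟩ T)  ≡⟨ sym (image-∘ g f T) ⟩
    (g ∘ f) ⟨$⟩ T    ≡⟨ image-cong (g ∘ f) id T (λ x _ → g∘f≗id x) ⟩
    id ⟨$⟩ T         ≡⟨ image-id T ⟩
    T                ∎
    where open ≡-Reasoning

  image-transport : (u φ h̄ v : Fin n → Fin n) {S S̄ S̄' S' : Subset n}
    → u ⟨$⟩ S ≡ S̄ → (∀ x → x ∈ S̄ → φ x ≡ h̄ x) → h̄ ⟨$⟩ S̄ ≡ S̄' → v ⟨$⟩ S̄' ≡ S'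
    → (v ∘ φ ∘ u) ⟨$⟩ S ≡ S'
  image-transport u φ h̄ v {S} {S̄} {S̄'} uS≡S̄ φ≗h̄ h̄S̄≡S̄' vS̄'≡S' = begin
    (v ∘ φ ∘ u) ⟨$⟩ S        ≡⟨ image-∘ v (φ ∘ u) S ⟩
    v ⟨$⟩ ((φ ∘ u) ⟨$⟩ S)    ≡⟨ cong (v ⟨$⟩_) (image-∘ φ u S) ⟩
    v ⟨$⟩ (φ ⟨$⟩ (u ⟨$⟩ S))  ≡⟨ cong (λ T → v ⟨$⟩ (φ ⟨$⟩ T)) uS≡S̄ ⟩
    v ⟨$⟩ (φ ⟨$⟩ S̄)          ≡⟨ cong (v ⟨$⟩_) (image-cong φ h̄ S̄ φ≗h̄) ⟩
    v ⟨$⟩ (h̄ ⟨$⟩ S̄)          ≡⟨ cong (v ⟨$⟩_) h̄S̄≡S̄' ⟩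
    v ⟨$⟩ S̄'                 ≡⟨ vS̄'≡S' ⟩
    _                        ∎
    where open ≡-Reasoning

open Images

module Cardinality {n : ℕ} where

  ∣p∣≡1+∣p-x∣ : ∀ {m} (p : Subset m) {x : Fin m} → x ∈ p → ∣ p ∣ ≡ suc ∣ p - x ∣
  ∣p∣≡1+∣p-x∣ (inside ∷ p)  here      = cong suc (sym (cong ∣_∣ (p─⊥≡p p)))
  ∣p∣≡1+∣p-x∣ (outside ∷ p) (there i) = ∣p∣≡1+∣p-x∣ p i
  ∣p∣≡1+∣p-x∣ (inside ∷ p)  (there i) = cong suc (∣p∣≡1+∣p-x∣ p i)

  x∈p─q⇒x∉q : ∀ {m} (p q : Subset m) {x : Fin m} → x ∈ p ─ q → x ∉ q
  x∈p─q⇒x∉q (_ ∷ p)      (inside ∷ q)  (there i) (there j) = x∈p─q⇒x∉q p q i j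
  x∈p─q⇒x∉q (_ ∷ p)      (outside ∷ q) (there i) (there j) = x∈p─q⇒x∉q p q i j
  x∈p─q⇒x∉q (inside ∷ p) (outside ∷ q) here      ()

  x∈p-y⇒x≢y : (p : Subset n) {x y : Fin n} → x ∈ p - y → ¬ (x ≡ y)
  x∈p-y⇒x≢y p {y = y} x∈ refl = x∈p─q⇒x∉q p ⁅ y ⁆ x∈ (x∈⁅x⁆ y)

  InjectiveOn : (Fin n → Fin n) → Subset n → Set
  InjectiveOn f T = ∀ x y → x ∈ T → y ∈ T → f x ≡ f y → x ≡ y

  image-remove : (f : Fin n → Fin n) (T : Subset n) {x : Fin n} → x ∈ T → InjectiveOn f T
    → (f ⟨$⟩ T) - f x ≡ f ⟨$⟩ (T - x)
  image-remove f T {x} x∈T inj = ⊆-antisym to from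
    where
    to : (f ⟨$⟩ T) - f x ⊆ f ⟨$⟩ (T - x)
    to z∈ with ∈-image⁻ f T (p─q⊆p (f ⟨$⟩ T) ⁅ f x ⁆ z∈)
    ... | w , w∈T , refl =
      ∈-image⁺ f (T - x) (x∈p∧x≢y⇒x∈p-y w∈T (λ w≡x → x∈p-y⇒x≢y (f ⟨$⟩ T) z∈ (cong f w≡x)))
    from : f ⟨$⟩ (T - x) ⊆ (f ⟨$⟩ T) - f x
    from z∈ with ∈-image⁻ f (T - x) z∈
    ... | w , w∈T-x , refl = x∈p∧x≢y⇒x∈p-y (∈-image⁺ f T w∈T)
                               (λ fw≡fx → x∈p-y⇒x≢y T w∈T-x (inj w x w∈T x∈T fw≡fx))
      where w∈T = p─q⊆p T ⁅ x ⁆ w∈T-x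

  image-size : (f : Fin n → Fin n) (m : ℕ) (T : Subset n) → ∣ T ∣ ≡ m → InjectiveOn f T
    → ∣ f ⟨$⟩ T ∣ ≡ m
  image-size f zero T ∣T∣≡0 _ = trans (cong ∣_∣ fT≡⊥) (∣⊥∣≡0 n)
    where
    T-empty : ∀ {x} → x ∉ T
    T-empty x∈T = 1+n≢0 (trans (sym (∣p∣≡1+∣p-x∣ T x∈T)) ∣T∣≡0)
    fT≡⊥ : f ⟨$⟩ T ≡ ⊥
    fT≡⊥ = ⊆-antisym (λ z∈ → ⊥-elim (T-empty (proj₁ (proj₂ (∈-image⁻ f T z∈)))))
                     (λ z∈ → ⊥-elim (∉⊥ z∈))
  image-size f (suc m) T ∣T∣≡1+m inj with nonempty? T
  ... | no T-empty =
    ⊥-elim (1+n≢0 (trans (sym ∣T∣≡1+m) (trans (cong ∣_∣ (Empty-unique T-empty)) (∣⊥∣≡0 n))))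
  ... | yes (x , x∈T) = begin
    ∣ f ⟨$⟩ T ∣              ≡⟨ ∣p∣≡1+∣p-x∣ (f ⟨$⟩ T) (∈-image⁺ f T x∈T) ⟩
    suc ∣ (f ⟨$⟩ T) - f x ∣  ≡⟨ cong (suc ∘ ∣_∣) (image-remove f T x∈T inj) ⟩
    suc ∣ f ⟨$⟩ (T - x) ∣    ≡⟨ cong suc (image-size f m (T - x) ∣T-x∣≡m inj-T-x) ⟩
    suc m                    ∎
    where
    open ≡-Reasoning
    ∣T-x∣≡m : ∣ T - x ∣ ≡ m
    ∣T-x∣≡m = suc-injective (trans (sym (∣p∣≡1+∣p-x∣ T x∈T)) ∣T∣≡1+m)
    inj-T-x : InjectiveOn f (T - x)
    inj-T-x a b a∈ b∈ = inj a b (p─q⊆p T ⁅ x ⁆ a∈) (p─q⊆p T ⁅ x ⁆ b∈)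

open Cardinality

module Automorphisms {n : ℕ} (ρ : Fin n → Fin n → Set) (𝔅 : Subset n → Set) where
  open IsAutomorphism

  Aut : (Fin n → Fin n) → Set
  Aut = IsAutomorphism ⊤ ρ 𝔅

  aut-id : Aut id
  aut-id = record
    { maps-P = λ _ _ → ∈⊤ ; inverse = id ; inverse-P = λ _ _ → ∈⊤
    ; left-inv = λ _ _ → refl ; right-inv = λ _ _ → refl
    ; classes = λ _ _ _ _ → mk⇔ id id
    ; blocks = λ B B∈𝔅 → subst 𝔅 (sym (image-id B)) B∈𝔅
    ; blocks-onto = λ B B∈𝔅 → B , B∈𝔅 , image-id B }

  aut-∘ : ∀ {f g} → Aut f → Aut g → Aut (f ∘ g)
  aut-∘ {f} {g} f-aut g-aut = record
    { maps-P = λ _ _ → ∈⊤ ; inverse = inverse g-aut ∘ inverse f-aut ; inverse-P = λ _ _ → ∈⊤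
    ; left-inv = λ x _ → trans (cong (inverse g-aut) (left-inv f-aut (g x) ∈⊤)) (left-inv g-aut x ∈⊤)
    ; right-inv = λ x _ → trans (cong f (right-inv g-aut (inverse f-aut x) ∈⊤)) (right-inv f-aut x ∈⊤)
    ; classes = λ x y _ _ →
        let g-cls = classes g-aut x y ∈⊤ ∈⊤
            f-cls = classes f-aut (g x) (g y) ∈⊤ ∈⊤
        in mk⇔ (Equivalence.to f-cls ∘ Equivalence.to g-cls) (Equivalence.from g-cls ∘ Equivalence.from f-cls)
    ; blocks = λ B B∈𝔅 → subst 𝔅 (sym (image-∘ f g B)) (blocks f-aut _ (blocks g-aut B B∈𝔅))
    ; blocks-onto = λ B B∈𝔅 →
        let (B₁ , B₁∈𝔅 , fB₁≡B) = blocks-onto f-aut B B∈𝔅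
            (B₂ , B₂∈𝔅 , gB₂≡B₁) = blocks-onto g-aut B₁ B₁∈𝔅
        in B₂ , B₂∈𝔅 , trans (image-∘ f g B₂) (trans (cong (f ⟨$⟩_) gB₂≡B₁) fB₁≡B) }

  aut-inverse : ∀ {f} → (f-aut : Aut f) → Aut (inverse f-aut)
  aut-inverse {f} f-aut = record
    { maps-P = λ _ _ → ∈⊤ ; inverse = f ; inverse-P = λ _ _ → ∈⊤
    ; left-inv = λ x _ → right-inv f-aut x ∈⊤
    ; right-inv = λ x _ → left-inv f-aut x ∈⊤
    ; classes = λ x y _ _ →
        let cls = classes f-aut (f⁻¹ x) (f⁻¹ y) ∈⊤ ∈⊤
            fix = right-inv f-aut x ∈⊤
            fiy = right-inv f-aut y ∈⊤
        in mk⇔ (λ r → Equivalence.from cls (subst₂ ρ (sym fix) (sym fiy) r))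
               (λ r → subst₂ ρ fix fiy (Equivalence.to cls r))
    ; blocks = λ B B∈𝔅 →
        let (B' , B'∈𝔅 , fB'≡B) = blocks-onto f-aut B B∈𝔅
        in subst 𝔅 (trans (sym (image-inverse f f⁻¹ B' f⁻¹∘f≗id)) (cong (f⁻¹ ⟨$⟩_) fB'≡B)) B'∈𝔅
    ; blocks-onto = λ B B∈𝔅 → f ⟨$⟩ B , blocks f-aut B B∈𝔅 , image-inverse f f⁻¹ B f⁻¹∘f≗id }
    where
    f⁻¹ = inverse f-aut
    f⁻¹∘f≗id : ∀ x → f⁻¹ (f x) ≡ x
    f⁻¹∘f≗id x = left-inv f-aut x ∈⊤

  autGroup : IsAutGroup ⊤ ρ 𝔅 Aut
  autGroup = record
    { auts = λ _ f-aut → f-aut ; id∈ = aut-id ; ∘∈ = λ _ _ → aut-∘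
    ; inv∈ = λ _ f-aut → inverse f-aut , aut-inverse f-aut ,
                         (λ x _ → left-inv f-aut x ∈⊤) , (λ x _ → right-inv f-aut x ∈⊤) }

module Lifting {n : ℕ} (t : ℕ) (X̄ : Subset n) (ρ̄ : Fin n → Fin n → Set) (𝔅̄ : Subset n → Set)
               (A : FiniteGroupAction n) (hat : Fin n → Fin n)
               (L : LiftingConditions t X̄ ρ̄ 𝔅̄ A hat) where
  open FiniteGroupAction A
  open LiftingConditions L
  open Automorphisms (liftedρ hat ρ̄) (liftedBlocks A 𝔅̄) public
  private module Grp = IsGroup isGroup

  act-cancelʳ : ∀ x g → (x ^ g) ^ (g ⁻¹) ≡ x
  act-cancelʳ x g = trans (sym (act-· x g (g ⁻¹))) (trans (cong (x ^_) (Grp.inverseʳ g)) (act-e x))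

  act-cancelˡ : ∀ x g → (x ^ (g ⁻¹)) ^ g ≡ x
  act-cancelˡ x g = trans (sym (act-· x (g ⁻¹) g)) (trans (cong (x ^_) (Grp.inverseˡ g)) (act-e x))

  -- x and x^g have the same orbit, hence (condition (a)) the same representative.
  orbit-shift : ∀ x g z → Orbit (x ^ g) z ⇔ Orbit x z
  orbit-shift x g z = mk⇔ (λ (h , xgh≡z) → g · h , trans (act-· x g h) xgh≡z)
    (λ (h , xh≡z) → (g ⁻¹) · h ,
       trans (act-· (x ^ g) (g ⁻¹) h) (trans (cong (_^ h) (act-cancelʳ x g)) xh≡z))

  hat-invariant : ∀ x g → hat (x ^ g) ≡ hat x
  hat-invariant x g = sym (a-unique (x ^ g) (hat x) (a-in x) λ z →
    mk⇔ (Equivalence.to (a-orbit x z) ∘ Equivalence.to (orbit-shift x g z))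
        (Equivalence.from (orbit-shift x g z) ∘ Equivalence.from (a-orbit x z)))

  act-block : ∀ g B → liftedBlocks A 𝔅̄ B → liftedBlocks A 𝔅̄ (act g ⟨$⟩ B)
  act-block g B (B̄ , g' , B̄∈𝔅̄ , B̄^g'≡B) = B̄ , g' · g , B̄∈𝔅̄ ,
    trans (image-cong (act (g' · g)) (act g ∘ act g') B̄ (λ x _ → act-· x g' g))
          (trans (image-∘ (act g) (act g') B̄) (cong (act g ⟨$⟩_) B̄^g'≡B))

  act-aut : ∀ g → Aut (act g)
  act-aut g = record
    { maps-P = λ _ _ → ∈⊤ ; inverse = act (g ⁻¹) ; inverse-P = λ _ _ → ∈⊤
    ; left-inv = λ x _ → act-cancelʳ x g
    ; right-inv = λ x _ → act-cancelˡ x g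
    ; classes = λ x y _ _ → mk⇔ (subst₂ ρ̄ (sym (hat-invariant x g)) (sym (hat-invariant y g)))
                                (subst₂ ρ̄ (hat-invariant x g) (hat-invariant y g))
    ; blocks = act-block g
    ; blocks-onto = λ B B∈𝔅 → act (g ⁻¹) ⟨$⟩ B , act-block (g ⁻¹) B B∈𝔅 ,
                              image-inverse (act (g ⁻¹)) (act g) B (λ x → act-cancelˡ x g) }

  -- The representatives of a ρ-transversal t-subset form a ρ̄-transversal
  -- t-subset of X̄: hat is injective on it because ρ̄ is reflexive.
  hat-transversal : (∀ x → ρ̄ x x) → ∀ Y → TransversalT t ⊤ (liftedρ hat ρ̄) Y
                  → TransversalT t X̄ ρ̄ (hat ⟨$⟩ Y)
  hat-transversal ρ̄-refl Y ((_ , Y-trans) , ∣Y∣≡t) = (Ŷ⊆X̄ , Ŷ-trans) , ∣Ŷ∣≡t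
    where
    Ŷ⊆X̄ : hat ⟨$⟩ Y ⊆ X̄
    Ŷ⊆X̄ z∈ with ∈-image⁻ hat Y z∈
    ... | x , _ , refl = a-in x
    Ŷ-trans : ∀ x̂ ŷ → x̂ ∈ hat ⟨$⟩ Y → ŷ ∈ hat ⟨$⟩ Y → ρ̄ x̂ ŷ → x̂ ≡ ŷ
    Ŷ-trans _ _ x̂∈ ŷ∈ r with ∈-image⁻ hat Y x̂∈ | ∈-image⁻ hat Y ŷ∈
    ... | x , x∈Y , refl | y , y∈Y , refl = cong hat (Y-trans x y x∈Y y∈Y r)
    ∣Ŷ∣≡t : ∣ hat ⟨$⟩ Y ∣ ≡ t
    ∣Ŷ∣≡t = image-size hat t Y ∣Y∣≡t
      (λ x y x∈Y y∈Y x̂≡ŷ → Y-trans x y x∈Y y∈Y (subst (ρ̄ (hat x)) x̂≡ŷ (ρ̄-refl (hat x))))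

  Extendable : ((Fin n → Fin n) → Set) → Set
  Extendable H̄ = ∀ h̄ → H̄ h̄ → ∃[ φ ] (Aut φ × (∀ x → x ∈ X̄ → φ x ≡ h̄ x))

  connect-via-H̄ : ∀ {H̄} → Extendable H̄ → ∀ {S S' S̄ S̄'} g g' h̄ → H̄ h̄ → S̄ ⊆ X̄
    → act g ⟨$⟩ S ≡ S̄ → h̄ ⟨$⟩ S̄ ≡ S̄' → act g' ⟨$⟩ S̄' ≡ S'
    → ∃[ h ] (Aut h × h ⟨$⟩ S ≡ S')
  connect-via-H̄ extend g g' h̄ h̄∈H̄ S̄⊆X̄ S^g≡S̄ S̄^h̄≡S̄' S̄'^g'≡S' with extend h̄ h̄∈H̄
  ... | φ , φ-aut , φ≗h̄ =
    act g' ∘ φ ∘ act g , aut-∘ (act-aut g') (aut-∘ φ-aut (act-aut g)) ,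
    image-transport (act g) φ h̄ (act g') S^g≡S̄ (λ x x∈S̄ → φ≗h̄ x (S̄⊆X̄ x∈S̄)) S̄^h̄≡S̄' S̄'^g'≡S'

  blocks-transitive : ∀ {H̄} → Extendable H̄ → (∀ B̄ → 𝔅̄ B̄ → B̄ ⊆ X̄) → BlockTransitive 𝔅̄ H̄
    → BlockTransitive (liftedBlocks A 𝔅̄) Aut
  blocks-transitive extend blocks⊆X̄ H̄-blocks _ _ (B̄ , g , B̄∈𝔅̄ , refl) (B̄' , g' , B̄'∈𝔅̄ , refl)
    with H̄-blocks B̄ B̄' B̄∈𝔅̄ B̄'∈𝔅̄
  ... | h̄ , h̄∈H̄ , B̄^h̄≡B̄' =
    connect-via-H̄ extend (g ⁻¹) g' h̄ h̄∈H̄ (blocks⊆X̄ B̄ B̄∈𝔅̄)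
      (image-inverse (act g) (act (g ⁻¹)) B̄ (λ x → act-cancelʳ x g)) B̄^h̄≡B̄' refl

  transversals-transitive : ∀ {H̄} → Extendable H̄ → (∀ x → ρ̄ x x) → TTransitive t X̄ ρ̄ H̄
    → TTransitive t ⊤ (liftedρ hat ρ̄) Aut
  transversals-transitive extend ρ̄-refl H̄-trans Y Y' Y-tr Y'-tr
    with hat-transversal ρ̄-refl Y Y-tr | hat-transversal ρ̄-refl Y' Y'-tr
  ... | Ŷ-tr | Ŷ'-tr with c Y (proj₂ Y-tr) Ŷ-tr | c Y' (proj₂ Y'-tr) Ŷ'-tr | H̄-trans _ _ Ŷ-tr Ŷ'-tr
  ... | g , Y^g≡Ŷ | g' , Y'^g'≡Ŷ' | h̄ , h̄∈H̄ , Ŷ^h̄≡Ŷ' =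
    connect-via-H̄ extend g (g' ⁻¹) h̄ h̄∈H̄ (proj₁ (proj₁ Ŷ-tr)) Y^g≡Ŷ Ŷ^h̄≡Ŷ'
      (trans (cong (act (g' ⁻¹) ⟨$⟩_) (sym Y'^g'≡Ŷ'))
             (image-inverse (act g') (act (g' ⁻¹)) Y' (λ x → act-cancelʳ x g')))

theorem2p6 : {n : ℕ} (t : ℕ) (X̄ : Subset n) (ρ̄ : Fin n → Fin n → Set) (𝔅̄ : Subset n → Set)
    → IsTDivisibleDesign t X̄ ρ̄ 𝔅̄
    → (A : FiniteGroupAction n) (hat : Fin n → Fin n)
    → LiftingConditions t X̄ ρ̄ 𝔅̄ A hat
    → (H̄ : (Fin n → Fin n) → Set)
    → IsAutGroup X̄ ρ̄ 𝔅̄ H̄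
    → BlockTransitive 𝔅̄ H̄
    → TTransitive t X̄ ρ̄ H̄
    → (∀ h̄ → H̄ h̄ → ∃[ φ ] (IsAutomorphism ⊤ (liftedρ hat ρ̄) (liftedBlocks A 𝔅̄) φ
                            × (∀ x → x ∈ X̄ → φ x ≡ h̄ x)))
    → ∃[ H ] (IsAutGroup ⊤ (liftedρ hat ρ̄) (liftedBlocks A 𝔅̄) H
              × BlockTransitive (liftedBlocks A 𝔅̄) H
              × TTransitive t ⊤ (liftedρ hat ρ̄) H)
theorem2p6 t X̄ ρ̄ 𝔅̄ D̄ A hat L H̄ _ H̄-blocks H̄-trans extend =
  Aut , autGroup ,
  blocks-transitive extend (λ B̄ B̄∈𝔅̄ → proj₁ (proj₁ (D̄.blocks B̄ B̄∈𝔅̄))) H̄-blocks ,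
  transversals-transitive extend (λ x → IsEquivalence.refl D̄.ρ-equiv) H̄-trans
  where
  open Lifting t X̄ ρ̄ 𝔅̄ A hat L
  module D̄ = IsTDivisibleDesign D̄
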